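{- For all positive integers $n$ and $s$, $\hat g(n,s)\ge\max\{s,\sqrt{2ns}-3s/2\}$. Consequently $\hat g(n,s)\ge\Omega(s+\sqrt{ns})$.
   Context: Token game: played on an array $B$ with rows indexed by the positive integers and columns indexed by a finite list; each cell $B(i,u)$ is empty or contains a token. A token in $B(i,u)$ is grounded if all cells of column $u$ below it (rows $1,\ldots,i-1$) contain tokens; otherwise ungrounded. One column is the active column. A step, with active column $u$: if column $u$ contains grounded tokens, the player may optionally move the highest grounded token of column $u$ from its cell $B(i,u)$ to an empty cell $B(i',v)$ with $i'\le i$, provided no prior step moved a token between columns $u$ and $v$; then all ungrounded tokens in column $u$ shift down by one cell, and the active column advances cyclically. A step moving a token between columns is a transfer step. An $(n,s)$-token game is a token game with $n$ columns, each initially containing at most $s$ tokens. $\hat g(n,s)$ is the maximum number of tokens that can be placed in a single column in an $(n,s)$-token game. -}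

module Defs where

open import Data.Nat using (ℕ; zero; suc; _+_; _*_; _≤_; _<_; _^_)
open import Data.Nat.DivMod using (_mod_)
open import Data.Bool using (Bool; true; false; _∧_; _∨_; not; if_then_else_)
open import Data.Fin using (Fin; toℕ; _≟_)
open import Data.List using (List; _∷_)
open import Data.List.Membership.Propositional using (_∈_)
open import Data.Product using (Σ; _×_; _,_)
open import Relation.Binary.PropositionalEquality using (_≡_)
open import Relation.Nullary using (¬_)
open import Relation.Binary.Construct.Closure.ReflexiveTransitive using (Star)

-- Conventions: rows are 0-indexed (row r here is row r+1 of the paper).
-- A column is a function ℕ → Bool (true = the cell contains a token).

Column : Set
Column = ℕ → Bool

Board : ℕ → Set
Board n = Fin n → Column

count : Column → ℕ → ℕ
count c zero    = zero
count c (suc N) = count c N + (if c N then 1 else 0)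

AtMost : ℕ → Column → Set
AtMost s c = ∀ N → count c N ≤ s

-- gr c r = true  iff  cell r contains a token and all cells below it contain tokens,
-- i.e. iff cell r contains a grounded token.
gr : Column → ℕ → Bool
gr c zero    = c zero
gr c (suc r) = gr c r ∧ c (suc r)

Grounded : Column → ℕ → Set
Grounded c r = gr c r ≡ true

HighestGrounded : Column → ℕ → Set
HighestGrounded c i = Grounded c i × ¬ Grounded c (suc i)

-- all ungrounded tokens shift down by one cell; grounded tokens stay.
-- New cell r is occupied iff old cell r holds a grounded token or old cell r+1
-- holds an ungrounded token.
shiftDown : Column → Column
shiftDown c r = gr c r ∨ (c (suc r) ∧ not (gr c (suc r)))

setCell : ∀ {n} → Board n → Fin n → ℕ → Bool → Board n
setCell B u r b v i with v ≟ u | i Data.Nat.≟ r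
... | Relation.Nullary.yes _ | Relation.Nullary.yes _ = b
... | _ | _ = B v i

setCol : ∀ {n} → Board n → Fin n → Column → Board n
setCol B u c v with v ≟ u
... | Relation.Nullary.yes _ = c
... | Relation.Nullary.no _  = B v

next : ∀ {n} → Fin n → Fin n
next {suc m} i = suc (toℕ i) mod suc m

-- a game state: the board, the active column, and the list of (ordered) pairs
-- (u , v) such that some earlier step moved a token from column u to column v
record State (n : ℕ) : Set where
  constructor ⟨_,_,_⟩
  field
    board  : Board n
    active : Fin n
    used   : List (Fin n × Fin n)
open State public

Fresh : ∀ {n} → List (Fin n × Fin n) → Fin n → Fin n → Set
Fresh us u v = ¬ ((u , v) ∈ us) × ¬ ((v , u) ∈ us)

data Step {n : ℕ} : State n → State n → Set where
  pass : ∀ B u us →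
    Step ⟨ B , u , us ⟩ ⟨ setCol B u (shiftDown (B u)) , next u , us ⟩
  transfer : ∀ B u us i v i' →
    HighestGrounded (B u) i →
    ¬ (v ≡ u) →
    B v i' ≡ false →
    i' ≤ i →
    Fresh us u v →
    let B₁ = setCell (setCell B u i false) v i' true in
    Step ⟨ B , u , us ⟩ ⟨ setCol B₁ u (shiftDown (B₁ u)) , next u , (u , v) ∷ us ⟩

Initial : ∀ {n} → ℕ → State n → Set
Initial s S = (∀ u → AtMost s (board S u)) × used S ≡ Data.List.[]

-- some (n,s)-token game can reach a position where a single column contains
-- at least k tokens; ĝ(n,s) ≥ k iff Achievable n s k
Achievable : ℕ → ℕ → ℕ → Set
Achievable n s k =
  Σ (State n) λ S₀ → Σ (State n) λ S →
    Initial s S₀ × Star Step S₀ S ×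
    Σ (Fin n) λ u → Σ ℕ λ N → k ≤ count (board S u) N

module Submission where

-- The game uses the columns 0, …, m (n = m + 1) and runs m + 1 rounds; in each round
-- the active column sweeps 0, …, m once.  Column x starts with its s tokens floating
-- at the rows quota x + x + 1, …, and they fall by one row whenever x is active.
-- In round j column j is the recipient: each of the quota j columns c just before it
-- (j − quota j ≤ c < j) moves its top token into row c − (j − quota j) of column j.
-- These tokens fill the rows 0, …, quota j − 1 just when the floating block of j has
-- fallen to row quota j + 1, so when j itself becomes active the block lands on them
-- and column j becomes a stack of quota j + s tokens; afterwards j is a donor.
-- Here quota j = s·p for the largest p with s·p(p+1) ≤ 2j; two estimates on it make
-- the strategy work: every donor has enough tokens for all its donations (quota-gap),
-- and quota m + s is large (quota-large).

open import Defs
open import Data.Nat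
  using (ℕ; zero; suc; _+_; _*_; _∸_; _^_; _≤_; _<_; _≟_; _<?_; _≤?_; z≤n; s≤s; s≤s⁻¹)
open import Data.Nat.Properties
open import Data.Nat.DivMod using (_%_; m<n⇒m%n≡m; n%n≡0)
open import Data.Nat.Tactic.RingSolver using (solve-∀)
open import Data.Fin as Fin using (Fin; toℕ; fromℕ<) renaming (_≟_ to _≟F_)
open import Data.Fin.Properties using (toℕ-injective; toℕ<n; toℕ-fromℕ<)
open import Data.Bool using (true; false; _∨_; if_then_else_)
open import Data.Bool.Properties using (∨-identityʳ; ∧-zeroʳ; ∧-identityʳ)
open import Data.List using (List; []; _∷_)
open import Data.List.Membership.Propositional using (_∈_)
open import Data.List.Relation.Unary.Any using (here; there)
open import Data.Product using (Σ; _×_; _,_; proj₁; proj₂)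
open import Data.Sum using (_⊎_; inj₁; inj₂)
open import Data.Empty using (⊥; ⊥-elim)
open import Relation.Nullary using (¬_; Dec; yes; no)
open import Relation.Binary.PropositionalEquality
  using (_≡_; _≢_; refl; sym; trans; cong; subst; ≢-sym; module ≡-Reasoning)
open import Relation.Binary.Construct.Closure.ReflexiveTransitive using (Star; ε; _◅_; _◅◅_)

module Schedule (s' : ℕ) where

  s : ℕ
  s = suc s'

  threshold : ℕ → ℕ
  threshold p = s * (p * suc p)

  threshold-suc : ∀ p → threshold (suc p) ≡ threshold p + 2 * (suc p * s)
  threshold-suc p = identity s p
    where
    identity : ∀ s p → s * (suc p * suc (suc p)) ≡ s * (p * suc p) + 2 * (suc p * s)
    identity = solve-∀

  threshold-mono : ∀ {p p'} → p ≤ p' → threshold p ≤ threshold p'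
  threshold-mono p≤p' = *-monoʳ-≤ s (*-mono-≤ p≤p' (s≤s p≤p'))

  Bracket : ℕ → ℕ → Set
  Bracket p j = threshold p ≤ 2 * j × 2 * j < threshold (suc p)

  raise : ℕ → ℕ → ℕ
  raise p j with threshold (suc p) ≤? 2 * suc j
  ... | yes _ = suc p
  ... | no _  = p

  raise-bracket : ∀ p j → Bracket p j → Bracket (raise p j) (suc j)
  raise-bracket p j (reached , below) with threshold (suc p) ≤? 2 * suc j
  ... | no ¬reached = ≤-trans reached (*-monoʳ-≤ 2 (n≤1+n j)) , ≰⇒> ¬reached
  ... | yes reached′ = reached′ , (begin-strict
        2 * suc j                                  ≡⟨ *-suc 2 j ⟩
        2 + 2 * j                                  <⟨ +-monoʳ-< 2 below ⟩
        2 + threshold (suc p)                      ≡⟨ +-comm 2 (threshold (suc p)) ⟩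
        threshold (suc p) + 2                      ≤⟨ +-monoʳ-≤ (threshold (suc p)) (*-monoʳ-≤ 2 (s≤s z≤n)) ⟩
        threshold (suc p) + 2 * (suc (suc p) * s)  ≡⟨ sym (threshold-suc (suc p)) ⟩
        threshold (suc (suc p))                    ∎)
    where open ≤-Reasoning

  -- level j is the largest p with threshold p ≤ 2j
  level : ℕ → ℕ
  level zero    = 0
  level (suc j) = raise (level j) j

  level-bracket : ∀ j → Bracket (level j) j
  level-bracket zero    = ≤-reflexive (*-zeroʳ s) , s≤s z≤n
  level-bracket (suc j) = raise-bracket (level j) j (level-bracket j)

  -- quota j: the number of tokens column j receives in its round
  quota : ℕ → ℕ
  quota j = level j * s

  -- a column receives at most one token from each column before it
  quota≤index : ∀ j → quota j ≤ j
  quota≤index j = bound (level j) (level-bracket j)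
    where
    bound : ∀ p → Bracket p j → p * s ≤ j
    bound zero    _            = z≤n
    bound (suc p) (reached , _) = *-cancelˡ-≤ 2 (begin
      2 * (suc p * s)                 ≤⟨ m≤n+m _ (threshold p) ⟩
      threshold p + 2 * (suc p * s)   ≡⟨ sym (threshold-suc p) ⟩
      threshold (suc p)               ≤⟨ reached ⟩
      2 * j                           ∎)
      where open ≤-Reasoning

  level-gap : ∀ i j → j ≤ i + quota j → level j ≤ suc (level i)
  level-gap i j j≤ = ≮⇒≥ (too-high (level j) (level-bracket j) j≤)
    where
    too-high : ∀ p → Bracket p j → j ≤ i + p * s → suc (level i) < p → ⊥
    too-high (suc p) (reached , _) j≤ (s≤s li<p) =
      <-irrefl refl (<-≤-trans (proj₂ (level-bracket i)) (≤-trans (threshold-mono li<p) thp≤2i))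
      where
      thp≤2i : threshold p ≤ 2 * i
      thp≤2i = +-cancelʳ-≤ (2 * (suc p * s)) (threshold p) (2 * i) (begin
        threshold p + 2 * (suc p * s)   ≡⟨ sym (threshold-suc p) ⟩
        threshold (suc p)               ≤⟨ reached ⟩
        2 * j                           ≤⟨ *-monoʳ-≤ 2 j≤ ⟩
        2 * (i + suc p * s)             ≡⟨ *-distribˡ-+ 2 i (suc p * s) ⟩
        2 * i + 2 * (suc p * s)         ∎)
        where open ≤-Reasoning

  -- a donor i of column j has itself received at least quota j − s tokens
  quota-gap : ∀ i j → j ≤ i + quota j → quota j ≤ s + quota i
  quota-gap i j j≤ = *-monoˡ-≤ s (level-gap i j j≤)

  quota-large : ∀ m → 8 * suc m * s ≤ (2 * (s + quota m) + 3 * s) ^ 2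
  quota-large m = begin
      8 * suc m * s                              ≡⟨ regroup m s ⟩
      4 * s * (2 * suc m)                        ≡⟨ cong (4 * s *_) (*-suc 2 m) ⟩
      4 * s * (2 + 2 * m)                        ≤⟨ *-monoʳ-≤ (4 * s) (s≤s below) ⟩
      4 * s * suc T                              ≡⟨ *-suc (4 * s) T ⟩
      4 * s + 4 * s * T                          ≤⟨ +-monoˡ-≤ (4 * s * T) (four-s≤ s' L) ⟩
      s * s * (8 * L + 17) + 4 * s * T           ≡⟨ sym (square s L) ⟩
      (2 * (s + L * s) + 3 * s) ^ 2              ∎
    where
    open ≤-Reasoning
    L : ℕ
    L = level m
    T : ℕ
    T = threshold (suc L)
    below : 2 * m < T
    below = proj₂ (level-bracket m)
    regroup : ∀ m s → 8 * (1 + m) * s ≡ 4 * s * (2 * (1 + m))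
    regroup = solve-∀
    four-s≤ : ∀ x y → 4 * (1 + x) ≤ (1 + x) * (1 + x) * (8 * y + 17)
    four-s≤ x y = ≤-trans (m≤m+n _ _) (≤-reflexive (expand x y))
      where
      expand : ∀ x y → 4 * (1 + x) + ((1 + x) * (13 + 8 * y) + x * (1 + x) * (8 * y + 17))
                      ≡ (1 + x) * (1 + x) * (8 * y + 17)
      expand = solve-∀
    square : ∀ s y → (2 * (s + y * s) + 3 * s) * ((2 * (s + y * s) + 3 * s) * 1)
                   ≡ s * s * (8 * y + 17) + 4 * s * (s * ((1 + y) * (2 + y)))
    square = solve-∀

_≈_ : Column → Column → Set
c ≈ c' = ∀ r → c r ≡ c' r

≈-trans : ∀ {c c' c''} → c ≈ c' → c' ≈ c'' → c ≈ c''
≈-trans e e' r = trans (e r) (e' r)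

block : ℕ → ℕ → Column
block zero    zero    r       = false
block zero    (suc l) zero    = true
block zero    (suc l) (suc r) = block zero l r
block (suc b) l       zero    = false
block (suc b) l       (suc r) = block b l r

stack : ℕ → Column
stack h = block 0 h

-- a stack of height h with a floating block of l tokens from row b
-- (note: shape 0 b l is definitionally block b l)
shape : ℕ → ℕ → ℕ → Column
shape h b l r = stack h r ∨ block b l r

stack-in : ∀ {h r} → r < h → stack h r ≡ true
stack-in {suc h} {zero}  _         = refl
stack-in {suc h} {suc r} (s≤s r<h) = stack-in r<h

stack-out : ∀ {h r} → h ≤ r → stack h r ≡ false
stack-out {zero}  {r}     _         = refl
stack-out {suc h} {suc r} (s≤s h≤r) = stack-out h≤r

stack-suc : ∀ {h r} → r ≢ h → stack (suc h) r ≡ stack h r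
stack-suc {zero}  {zero}  r≢h = ⊥-elim (r≢h refl)
stack-suc {suc h} {zero}  _   = refl
stack-suc {zero}  {suc r} _   = refl
stack-suc {suc h} {suc r} r≢h = stack-suc (λ e → r≢h (cong suc e))

block-below : ∀ {b l r} → r < b → block b l r ≡ false
block-below {suc b} {l} {zero}  _         = refl
block-below {suc b} {l} {suc r} (s≤s r<b) = block-below {b} {l} r<b

block-in : ∀ {b l r} → b ≤ r → r < b + l → block b l r ≡ true
block-in {zero}                  _         r<l       = stack-in r<l
block-in {suc b} {l} {suc r} (s≤s b≤r) (s≤s r<b+l) = block-in {b} {l} b≤r r<b+l

block-above : ∀ {b l r} → b + l ≤ r → block b l r ≡ false
block-above {zero}                 b+l≤r     = stack-out b+l≤r
block-above {suc b} {l} {zero}     ()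
block-above {suc b} {l} {suc r} (s≤s b+l≤r) = block-above {b} {l} b+l≤r

shape-merge : ∀ h l → shape h h l ≈ stack (h + l)
shape-merge h l r with r <? h | r <? h + l
... | yes r<h | _ rewrite stack-in r<h | stack-in {h + l} (<-≤-trans r<h (m≤m+n h l)) = refl
... | no r≮h | yes r<h+l
  rewrite stack-out (≮⇒≥ r≮h) | block-in {h} {l} (≮⇒≥ r≮h) r<h+l | stack-in r<h+l = refl
... | no r≮h | no r≮h+l
  rewrite stack-out (≮⇒≥ r≮h) | block-above {h} {l} (≮⇒≥ r≮h+l) | stack-out (≮⇒≥ r≮h+l) = refl

shape-top-empty : ∀ {t b l} → t < b → shape t b l t ≡ false
shape-top-empty {t} {b} {l} t<b rewrite stack-out {t} ≤-refl = block-below {b} {l} t<b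

gr-above-gap : ∀ {c a r} → c a ≡ false → a ≤ r → gr c r ≡ false
gr-above-gap {c} {a} {r} gap a≤r = subst (λ r → gr c r ≡ false) (m∸n+n≡m a≤r) (climb (r ∸ a))
  where
  at-gap : ∀ a → c a ≡ false → gr c a ≡ false
  at-gap zero    gap = gap
  at-gap (suc a) gap rewrite gap = ∧-zeroʳ (gr c a)
  climb : ∀ k → gr c (k + a) ≡ false
  climb zero                     = at-gap a gap
  climb (suc k) rewrite climb k = refl

gr-stack : ∀ {c h} → (∀ r → r < h → c r ≡ true) → c h ≡ false → ∀ r → gr c r ≡ stack h r
gr-stack {c} {h} full gap r with r <? h
... | yes r<h = trans (grounded r r<h) (sym (stack-in r<h))
  where
  grounded : ∀ r → r < h → gr c r ≡ true
  grounded zero    r<h = full zero r<h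
  grounded (suc r) r<h rewrite grounded r (<-trans (n<1+n r) r<h) = full (suc r) r<h
... | no r≮h = trans (gr-above-gap gap (≮⇒≥ r≮h)) (sym (stack-out (≮⇒≥ r≮h)))

gr-of-stack : ∀ {c h} → c ≈ stack h → ∀ r → gr c r ≡ stack h r
gr-of-stack {c} {h} e =
  gr-stack {h = h} (λ r r<h → trans (e r) (stack-in r<h)) (trans (e h) (stack-out {h} ≤-refl))

stack-top-highest : ∀ {c h} → c ≈ stack (suc h) → HighestGrounded c h
stack-top-highest {c} {h} e =
  trans (gr-of-stack {h = suc h} e h) (stack-in {suc h} ≤-refl) ,
  λ grounded → true≢false (trans (sym grounded)
                  (trans (gr-of-stack {h = suc h} e (suc h)) (stack-out {suc h} ≤-refl)))
  where
  true≢false : true ≢ false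
  true≢false ()

gr-shape : ∀ {c h b l} → block b l h ≡ false → c ≈ shape h b l → ∀ r → gr c r ≡ stack h r
gr-shape {c} {h} {b} {l} gap e = gr-stack {h = h} full empty
  where
  full : ∀ r → r < h → c r ≡ true
  full r r<h rewrite e r | stack-in r<h = refl
  empty : c h ≡ false
  empty rewrite e h | stack-out {h} ≤-refl = gap

-- the cells of a stack form an initial segment
stack-downward : ∀ h r x → stack h r ∨ (stack h (suc r) ∨ x) ≡ stack h r ∨ x
stack-downward zero    r       x = refl
stack-downward (suc h) zero    x = refl
stack-downward (suc h) (suc r) x = stack-downward h r x

shiftDown-over-stack : ∀ {c h} → (∀ r → gr c r ≡ stack h r) →
                       ∀ r → shiftDown c r ≡ stack h r ∨ c (suc r)
shiftDown-over-stack {c} {h} grounds r rewrite grounds r with stack h r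
... | true  = refl
... | false = ∧-identityʳ (c (suc r))

shiftDown-shape : ∀ {c h b l} → h ≤ b → c ≈ shape h (suc b) l → shiftDown c ≈ shape h b l
shiftDown-shape {c} {h} {b} {l} h≤b e r = begin
  shiftDown c r                                      ≡⟨ shiftDown-over-stack {h = h} grounds r ⟩
  stack h r ∨ c (suc r)                              ≡⟨ cong (stack h r ∨_) (e (suc r)) ⟩
  stack h r ∨ (stack h (suc r) ∨ block b l r)        ≡⟨ stack-downward h r (block b l r) ⟩
  stack h r ∨ block b l r                            ∎
  where
  open ≡-Reasoning
  grounds : ∀ r → gr c r ≡ stack h r
  grounds = gr-shape {h = h} {suc b} {l} (block-below {suc b} {l} (s≤s h≤b)) e

shiftDown-stack : ∀ {c h} → c ≈ stack h → shiftDown c ≈ stack h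
shiftDown-stack {c} {h} e r = begin
  shiftDown c r                                      ≡⟨ shiftDown-over-stack {h = h} (gr-of-stack {h = h} e) r ⟩
  stack h r ∨ c (suc r)                              ≡⟨ cong (stack h r ∨_) (e (suc r)) ⟩
  stack h r ∨ stack h (suc r)                        ≡⟨ cong (stack h r ∨_) (sym (∨-identityʳ _)) ⟩
  stack h r ∨ (stack h (suc r) ∨ false)              ≡⟨ stack-downward h r false ⟩
  stack h r ∨ false                                  ≡⟨ ∨-identityʳ (stack h r) ⟩
  stack h r                                          ∎
  where open ≡-Reasoning

setCell-hit : ∀ {n} (B : Board n) u r b → setCell B u r b u r ≡ b
setCell-hit B u r b with u ≟F u | r ≟ r
... | yes _   | yes _   = refl
... | no u≢u  | _       = ⊥-elim (u≢u refl)
... | yes _   | no r≢r  = ⊥-elim (r≢r refl)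

setCell-miss : ∀ {n} (B : Board n) u r b v i → v ≢ u ⊎ i ≢ r → setCell B u r b v i ≡ B v i
setCell-miss B u r b v i elsewhere with v ≟F u | i ≟ r
... | yes _   | no _    = refl
... | no _    | yes _   = refl
... | no _    | no _    = refl
... | yes v≡u | yes i≡r with elsewhere
...   | inj₁ v≢u = ⊥-elim (v≢u v≡u)
...   | inj₂ i≢r = ⊥-elim (i≢r i≡r)

setCol-hit : ∀ {n} (B : Board n) u c → setCol B u c u ≡ c
setCol-hit B u c with u ≟F u
... | yes _   = refl
... | no u≢u  = ⊥-elim (u≢u refl)

setCol-miss : ∀ {n} (B : Board n) u c v → v ≢ u → setCol B u c v ≡ B v
setCol-miss B u c v v≢u with v ≟F u
... | yes v≡u = ⊥-elim (v≢u v≡u)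
... | no _    = refl

setCell-elsewhere : ∀ {n} (B : Board n) u r b v → v ≢ u → setCell B u r b v ≈ B v
setCell-elsewhere B u r b v v≢u i = setCell-miss B u r b v i (inj₁ v≢u)

remove-top : ∀ {n} (B : Board n) u h → B u ≈ stack (suc h) → setCell B u h false u ≈ stack h
remove-top B u h e r = by-row (r ≟ h)
  where
  by-row : Dec (r ≡ h) → setCell B u h false u r ≡ stack h r
  by-row (yes refl) = trans (setCell-hit B u r false) (sym (stack-out {r} ≤-refl))
  by-row (no r≢h)   = trans (setCell-miss B u h false u r (inj₂ r≢h)) (trans (e r) (stack-suc r≢h))

add-on-top : ∀ {n} (B : Board n) v t b l → B v ≈ shape t b l → setCell B v t true v ≈ shape (suc t) b l
add-on-top B v t b l e r = by-row (r ≟ t)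
  where
  by-row : Dec (r ≡ t) → setCell B v t true v r ≡ shape (suc t) b l r
  by-row (yes refl) = trans (setCell-hit B v r true) (cong (_∨ block b l r) (sym (stack-in {suc r} ≤-refl)))
  by-row (no r≢t)   = trans (setCell-miss B v t true v r (inj₂ r≢t))
                            (trans (e r) (cong (_∨ block b l r) (sym (stack-suc r≢t))))

count-cong : ∀ {c c'} → c ≈ c' → ∀ K → count c K ≡ count c' K
count-cong e zero                     = refl
count-cong e (suc K) rewrite count-cong e K | e K = refl

count-bottom : ∀ c K → count c (suc K) ≡ (if c 0 then 1 else 0) + count (λ r → c (suc r)) K
count-bottom c zero    = +-comm 0 (if c 0 then 1 else 0)
count-bottom c (suc K) rewrite count-bottom c K = +-assoc (if c 0 then 1 else 0) _ _

count-block : ∀ b l K → count (block b l) K ≤ l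
count-block b       l       zero    = z≤n
count-block (suc b) l       (suc K) rewrite count-bottom (block (suc b) l) K = count-block b l K
count-block zero    zero    (suc K) rewrite count-bottom (block 0 0) K = count-block 0 0 K
count-block zero    (suc l) (suc K) rewrite count-bottom (stack (suc l)) K = s≤s (count-block 0 l K)

count-stack : ∀ h → count (stack h) h ≡ h
count-stack zero                                         = refl
count-stack (suc h) rewrite count-bottom (stack (suc h)) h = cong suc (count-stack h)

module Strategy (s' m : ℕ) where
  open Schedule s'

  N : ℕ
  N = suc m

  -- the row of column j into which donor c puts its token during round j
  landing : ℕ → ℕ → ℕ
  landing j c = c ∸ (j ∸ quota j)

  -- The shape of column x at step c of round j (c = the active column).
  -- Index ₀: column x has not yet been active in round j; index ₁: it has.
  data ColumnShape (j c x : ℕ) (col : Column) : Set where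
    -- a donor holds a stack of some height h; it had quota x + s tokens after its
    -- own round x and gives at most one token per round, whence the budget on h + j,
    -- which keeps its top above the rows where its tokens land (landing<height)
    donor₀     : x < j → c ≤ x → (h : ℕ) → col ≈ stack h → s + quota x + x < h + j →
                 ColumnShape j c x col
    donor₁     : x < j → x < c → (h : ℕ) → col ≈ stack h → s + quota x + x ≤ h + j →
                 ColumnShape j c x col
    -- the recipient has received the tokens of the donors before c, and its own
    -- s tokens float just above the rows reserved for its quota
    recipient₀ : x ≡ j → c ≤ j → col ≈ shape (landing j c) (suc (quota j)) s →
                 ColumnShape j c x col
    recipient₁ : x ≡ j → j < c → col ≈ stack (quota j + s) → ColumnShape j c x col
    -- a pending column holds its original s tokens, falling one row per round
    pending₀   : j < x → c ≤ x → col ≈ block (suc (quota x + x ∸ j)) s → ColumnShape j c x col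
    pending₁   : j < x → x < c → col ≈ block (quota x + x ∸ j) s → ColumnShape j c x col

  ColumnShape-≈ : ∀ {j c x col col'} → col' ≈ col → ColumnShape j c x col → ColumnShape j c x col'
  ColumnShape-≈ e' (donor₀ x<j c≤x h e budget)  = donor₀ x<j c≤x h (≈-trans e' e) budget
  ColumnShape-≈ e' (donor₁ x<j x<c h e budget)  = donor₁ x<j x<c h (≈-trans e' e) budget
  ColumnShape-≈ e' (recipient₀ x≡j c≤j e)       = recipient₀ x≡j c≤j (≈-trans e' e)
  ColumnShape-≈ e' (recipient₁ x≡j j<c e)       = recipient₁ x≡j j<c (≈-trans e' e)
  ColumnShape-≈ e' (pending₀ j<x c≤x e)         = pending₀ j<x c≤x (≈-trans e' e)
  ColumnShape-≈ e' (pending₁ j<x x<c e)         = pending₁ j<x x<c (≈-trans e' e)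

  PastTransfers : ℕ → ℕ → List (Fin N × Fin N) → Set
  PastTransfers j c us = ∀ {a b} → (a , b) ∈ us →
    toℕ a < toℕ b × (toℕ b < j ⊎ (toℕ b ≡ j × toℕ a < c))

  Inv : ℕ → ℕ → State N → Set
  Inv j c S = toℕ (active S) ≡ c % N × PastTransfers j c (used S)
            × (∀ x → ColumnShape j c (toℕ x) (board S x))

  active-index : ∀ {j c S} → c < N → Inv j c S → toℕ (active S) ≡ c
  active-index c<N (active≡ , _) = trans active≡ (m<n⇒m%n≡m c<N)

  next-active : ∀ (u : Fin N) → toℕ (next u) ≡ suc (toℕ u) % N
  next-active u = toℕ-fromℕ< _

  past-step : ∀ {j c us} → PastTransfers j c us → PastTransfers j (suc c) us
  past-step past p with past p
  ... | a<b , inj₁ b<j         = a<b , inj₁ b<j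
  ... | a<b , inj₂ (b≡j , a<c) = a<b , inj₂ (b≡j , m<n⇒m<1+n a<c)

  -- Column x is unchanged while another column c is active; its description
  -- stays valid as long as the recipient does not miss a token, i.e. c is no donor.
  other-step : ∀ {j c x col} → x ≢ c → (x ≡ j → c < j → suc c ≤ j ∸ quota j) →
               ColumnShape j c x col → ColumnShape j (suc c) x col
  other-step x≢c _ (donor₀ x<j c≤x h e budget) = donor₀ x<j (≤∧≢⇒< c≤x (≢-sym x≢c)) h e budget
  other-step x≢c _ (donor₁ x<j x<c h e budget) = donor₁ x<j (m<n⇒m<1+n x<c) h e budget
  other-step {j} {c} {x} {col} x≢c no-donor (recipient₀ refl c≤j e) =
    recipient₀ refl c<j (subst (λ t → col ≈ shape t (suc (quota j)) s) both-zero e)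
    where
    c<j : c < j
    c<j = ≤∧≢⇒< c≤j (≢-sym x≢c)
    both-zero : landing j c ≡ landing j (suc c)
    both-zero = trans (m≤n⇒m∸n≡0 (<⇒≤ (no-donor refl c<j))) (sym (m≤n⇒m∸n≡0 (no-donor refl c<j)))
  other-step x≢c _ (recipient₁ x≡j j<c e) = recipient₁ x≡j (m<n⇒m<1+n j<c) e
  other-step x≢c _ (pending₀ j<x c≤x e)   = pending₀ j<x (≤∧≢⇒< c≤x (≢-sym x≢c)) e
  other-step x≢c _ (pending₁ j<x x<c e)   = pending₁ j<x (m<n⇒m<1+n x<c) e

  -- the active column c shifts down without giving a token; for the recipient
  -- this is the step at which its block lands on the tokens it has received
  pass-self : ∀ {j c col} → ColumnShape j c c col → ColumnShape j (suc c) c (shiftDown col)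
  pass-self {j} {c} (donor₀ c<j _ h e budget) =
    donor₁ c<j (n<1+n c) h (shiftDown-stack {h = h} e) (<⇒≤ budget)
  pass-self (donor₁ _ c<c _ _ _) = ⊥-elim (<-irrefl refl c<c)
  pass-self {j} {c} {col} (recipient₀ refl _ e) =
    recipient₁ refl (n<1+n j) (≈-trans (shiftDown-shape {h = quota j} ≤-refl e′) (shape-merge (quota j) s))
    where
    e′ : col ≈ shape (quota j) (suc (quota j)) s
    e′ = subst (λ t → col ≈ shape t (suc (quota j)) s) (m∸[m∸n]≡n (quota≤index j)) e
  pass-self (recipient₁ refl j<j _) = ⊥-elim (<-irrefl refl j<j)
  pass-self {j} {c} (pending₀ j<c _ e) = pending₁ j<c (n<1+n c) (shiftDown-shape {h = 0} z≤n e)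
  pass-self (pending₁ _ c<c _) = ⊥-elim (<-irrefl refl c<c)

  pass-step : ∀ j B u us → (toℕ u < j → suc (toℕ u) ≤ j ∸ quota j) →
    Inv j (toℕ u) ⟨ B , u , us ⟩ → Inv j (suc (toℕ u)) ⟨ setCol B u (shiftDown (B u)) , next u , us ⟩
  pass-step j B u us no-donor (_ , past , shapes) = next-active u , past-step past , λ x → by-column x (x ≟F u)
    where
    by-column : ∀ x → Dec (x ≡ u) → ColumnShape j (suc (toℕ u)) (toℕ x) (setCol B u (shiftDown (B u)) x)
    by-column x (yes refl) = subst (ColumnShape j (suc (toℕ x)) (toℕ x)) (sym (setCol-hit B x (shiftDown (B x))))
                                   (pass-self (shapes x))
    by-column x (no x≢u)   = subst (ColumnShape j (suc (toℕ u)) (toℕ x))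
                                   (sym (setCol-miss B u (shiftDown (B u)) x x≢u))
                                   (other-step (λ x≡u → x≢u (toℕ-injective x≡u)) (λ _ → no-donor) (shapes x))

  donor-stack : ∀ {j c col} → c < j → ColumnShape j c c col →
                Σ ℕ λ h → col ≈ stack h × s + quota c + c < h + j
  donor-stack _   (donor₀ _ _ h e budget)  = h , e , budget
  donor-stack _   (donor₁ _ c<c _ _ _)     = ⊥-elim (<-irrefl refl c<c)
  donor-stack c<j (recipient₀ refl _ _)    = ⊥-elim (<-irrefl refl c<j)
  donor-stack c<j (recipient₁ refl _ _)    = ⊥-elim (<-irrefl refl c<j)
  donor-stack c<j (pending₀ j<c _ _)       = ⊥-elim (<-asym c<j j<c)
  donor-stack c<j (pending₁ j<c _ _)       = ⊥-elim (<-asym c<j j<c)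

  recipient-shape : ∀ {j c col} → c < j → ColumnShape j c j col →
                    col ≈ shape (landing j c) (suc (quota j)) s
  recipient-shape _   (donor₀ j<j _ _ _ _)  = ⊥-elim (<-irrefl refl j<j)
  recipient-shape _   (donor₁ j<j _ _ _ _)  = ⊥-elim (<-irrefl refl j<j)
  recipient-shape _   (recipient₀ _ _ e)    = e
  recipient-shape c<j (recipient₁ _ j<c _)  = ⊥-elim (<-asym c<j j<c)
  recipient-shape _   (pending₀ j<j _ _)    = ⊥-elim (<-irrefl refl j<j)
  recipient-shape _   (pending₁ j<j _ _)    = ⊥-elim (<-irrefl refl j<j)

  landing-sum : ∀ j c → j ∸ quota j ≤ c → landing j c + j ≡ c + quota j
  landing-sum j c donor = begin
    landing j c + j                              ≡⟨ cong (landing j c +_) (sym (m∸n+n≡m (quota≤index j))) ⟩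
    landing j c + ((j ∸ quota j) + quota j)      ≡⟨ sym (+-assoc (landing j c) (j ∸ quota j) (quota j)) ⟩
    (landing j c + (j ∸ quota j)) + quota j      ≡⟨ cong (_+ quota j) (m∸n+n≡m donor) ⟩
    c + quota j                                  ∎
    where open ≡-Reasoning

  landing-suc : ∀ j c → j ∸ quota j ≤ c → landing j (suc c) ≡ suc (landing j c)
  landing-suc j c donor = +-∸-assoc 1 donor

  landing<quota : ∀ j c → c < j → j ∸ quota j ≤ c → landing j c < suc (quota j)
  landing<quota j c c<j donor = s≤s (+-cancelʳ-≤ j (landing j c) (quota j) (begin
    landing j c + j    ≡⟨ landing-sum j c donor ⟩
    c + quota j        ≤⟨ +-monoˡ-≤ (quota j) (<⇒≤ c<j) ⟩
    j + quota j        ≡⟨ +-comm j (quota j) ⟩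
    quota j + j        ∎))
    where open ≤-Reasoning

  landing<height : ∀ j c h → j ∸ quota j ≤ c → s + quota c + c < h + j → landing j c < h
  landing<height j c h donor budget = +-cancelʳ-< j (landing j c) h (begin-strict
    landing j c + j          ≡⟨ landing-sum j c donor ⟩
    c + quota j              ≤⟨ +-monoʳ-≤ c (quota-gap c j j≤c+quota) ⟩
    c + (s + quota c)        ≡⟨ +-comm c (s + quota c) ⟩
    s + quota c + c          <⟨ budget ⟩
    h + j                    ∎)
    where
    open ≤-Reasoning
    j≤c+quota : j ≤ c + quota j
    j≤c+quota = begin
      j                        ≡⟨ sym (m∸n+n≡m (quota≤index j)) ⟩
      (j ∸ quota j) + quota j  ≤⟨ +-monoˡ-≤ (quota j) donor ⟩
      c + quota j              ∎

  fresh-pair : ∀ {j us} {u v : Fin N} → PastTransfers j (toℕ u) us → toℕ v ≡ j → toℕ u < j →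
               Fresh us u v
  fresh-pair {u = u} past v≡j u<j = forward , backward
    where
    forward : ¬ (_ , _) ∈ _
    forward p with past p
    ... | _ , inj₁ v<j          = <-irrefl v≡j v<j
    ... | _ , inj₂ (_ , u<u)    = <-irrefl refl u<u
    backward : ¬ (_ , _) ∈ _
    backward p = <-asym u<j (subst (_< toℕ u) v≡j (proj₁ (past p)))

  record-transfer : ∀ {j us} {u v : Fin N} → PastTransfers j (toℕ u) us → toℕ v ≡ j → toℕ u < j →
                    PastTransfers j (suc (toℕ u)) ((u , v) ∷ us)
  record-transfer {u = u} _ v≡j u<j (here refl) =
    subst (toℕ u <_) (sym v≡j) u<j , inj₂ (v≡j , n<1+n (toℕ u))
  record-transfer past _ _ (there p)            = past-step past p

  transfer-step : ∀ j B u us → j < N → toℕ u < j → j ∸ quota j ≤ toℕ u →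
                  Inv j (toℕ u) ⟨ B , u , us ⟩ →
                  Σ (State N) λ S' → Step ⟨ B , u , us ⟩ S' × Inv j (suc (toℕ u)) S'
  transfer-step j B u us j<N u<j donor (_ , past , shapes) with donor-stack u<j (shapes u)
  ... | zero , _ , budget  = ⊥-elim (n≮0 (landing<height j (toℕ u) zero donor budget))
  ... | suc h , e , budget =
    _ , transfer B u us h v t (stack-top-highest {h = h} e) v≢u recipient-gap
                 (s≤s⁻¹ (landing<height j (toℕ u) (suc h) donor budget)) (fresh-pair past v≡j u<j) ,
    next-active u , record-transfer past v≡j u<j , λ x → by-column x (x ≟F u) (x ≟F v)
    where
    v : Fin N
    v = fromℕ< j<N
    v≡j : toℕ v ≡ j
    v≡j = toℕ-fromℕ< j<N
    v≢u : ¬ v ≡ u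
    v≢u v≡u = <-irrefl (trans (sym (cong toℕ v≡u)) v≡j) u<j
    t : ℕ
    t = landing j (toℕ u)
    recipient : B v ≈ shape t (suc (quota j)) s
    recipient = recipient-shape u<j (subst (λ y → ColumnShape j (toℕ u) y (B v)) v≡j (shapes v))
    recipient-gap : B v t ≡ false
    recipient-gap =
      trans (recipient t) (shape-top-empty {t} {suc (quota j)} {s} (landing<quota j (toℕ u) u<j donor))
    B₁ : Board N
    B₁ = setCell (setCell B u h false) v t true
    by-column : ∀ x → Dec (x ≡ u) → Dec (x ≡ v) →
                ColumnShape j (suc (toℕ u)) (toℕ x) (setCol B₁ u (shiftDown (B₁ u)) x)
    by-column x (yes refl) _ =
      subst (ColumnShape j (suc (toℕ x)) (toℕ x)) (sym (setCol-hit B₁ x (shiftDown (B₁ x))))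
        (donor₁ u<j (n<1+n (toℕ x)) h
          (shiftDown-stack {h = h} (≈-trans (setCell-elsewhere _ v t true x (≢-sym v≢u)) (remove-top B x h e)))
          (s≤s⁻¹ budget))
    by-column x (no x≢u) (yes refl) =
      subst (ColumnShape j (suc (toℕ u)) (toℕ x)) (sym (setCol-miss B₁ u (shiftDown (B₁ u)) x x≢u))
        (recipient₀ v≡j u<j
          (subst (λ t' → B₁ x ≈ shape t' (suc (quota j)) s) (sym (landing-suc j (toℕ u) donor))
            (add-on-top (setCell B u h false) x t (suc (quota j)) s
              (≈-trans (setCell-elsewhere B u h false x x≢u) recipient))))
    by-column x (no x≢u) (no x≢v) =
      subst (ColumnShape j (suc (toℕ u)) (toℕ x)) (sym (setCol-miss B₁ u (shiftDown (B₁ u)) x x≢u))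
        (ColumnShape-≈ (≈-trans (setCell-elsewhere _ v t true x x≢v) (setCell-elsewhere B u h false x x≢u))
          (other-step (λ x≡u → x≢u (toℕ-injective x≡u))
                      (λ x≡j _ → ⊥-elim (x≢v (toℕ-injective (trans x≡j (sym v≡j)))))
                      (shapes x)))

  step : ∀ j c S → j < N → c < N → Inv j c S → Σ (State N) λ S' → Step S S' × Inv j (suc c) S'
  step j c ⟨ B , u , us ⟩ j<N c<N inv with active-index {S = ⟨ B , u , us ⟩} c<N inv
  ... | refl with toℕ u <? j | j ∸ quota j ≤? toℕ u
  ... | yes u<j | yes donor  = transfer-step j B u us j<N u<j donor inv
  ... | yes _   | no ¬donor  = _ , pass B u us , pass-step j B u us (λ _ → ≰⇒> ¬donor) inv
  ... | no u≮j  | _          = _ , pass B u us , pass-step j B u us (λ u<j → ⊥-elim (u≮j u<j)) inv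

  round : ∀ j k c S → j < N → k + c ≡ N → Inv j c S → Σ (State N) λ S' → Star Step S S' × Inv j N S'
  round j zero    c S _   refl inv = S , ε , inv
  round j (suc k) c S j<N k+c≡N inv with step j c S j<N (≤-trans (s≤s (m≤n+m c k)) (≤-reflexive k+c≡N)) inv
  ... | S₁ , move , inv₁ with round j k (suc c) S₁ j<N (trans (+-suc k c) k+c≡N) inv₁
  ... | S₂ , moves , inv₂ = S₂ , move ◅ moves , inv₂

  pending-fall : ∀ j x → j < x → quota x + x ∸ j ≡ suc (quota x + x ∸ suc j)
  pending-fall j x j<x = +-∸-assoc 1 (≤-trans j<x (m≤n+m x (quota x)))

  next-round-shape : ∀ {j x col} → x < N → ColumnShape j N x col → ColumnShape (suc j) 0 x col
  next-round-shape x<N (donor₀ _ N≤x _ _ _)     = ⊥-elim (<⇒≱ x<N N≤x)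
  next-round-shape {j} _ (donor₁ x<j _ h e budget) =
    donor₀ (m<n⇒m<1+n x<j) z≤n h e (≤-trans (s≤s budget) (≤-reflexive (sym (+-suc h j))))
  next-round-shape x<N (recipient₀ refl N≤x _)  = ⊥-elim (<⇒≱ x<N N≤x)
  next-round-shape {j} _ (recipient₁ refl _ e)  =
    donor₀ (n<1+n j) z≤n (quota j + s) e (≤-reflexive (rearrange s (quota j) j))
    where
    rearrange : ∀ a b j → suc (a + b + j) ≡ b + a + suc j
    rearrange = solve-∀
  next-round-shape x<N (pending₀ _ N≤x _)       = ⊥-elim (<⇒≱ x<N N≤x)
  next-round-shape {j} {x} {col} _ (pending₁ j<x _ e) with x ≟ suc j
  ... | yes refl = recipient₀ refl z≤n
        (subst (λ t → col ≈ shape t (suc (quota x)) s) (sym (0∸n≡0 (x ∸ quota x)))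
          (subst (λ b → col ≈ block b s) (trans (pending-fall j x j<x) (cong suc (m+n∸n≡m (quota x) x))) e))
  ... | no x≢1+j =
        pending₀ (≤∧≢⇒< j<x (≢-sym x≢1+j)) z≤n (subst (λ b → col ≈ block b s) (pending-fall j x j<x) e)

  next-round : ∀ j S → Inv j N S → Inv (suc j) 0 S
  next-round j S (active≡ , past , shapes) =
    trans active≡ (n%n≡0 N) , past′ , λ x → next-round-shape (toℕ<n x) (shapes x)
    where
    past′ : PastTransfers (suc j) 0 (used S)
    past′ p with past p
    ... | a<b , inj₁ b<j       = a<b , inj₁ (m<n⇒m<1+n b<j)
    ... | a<b , inj₂ (b≡j , _) = a<b , inj₁ (subst (_< suc j) (sym b≡j) (n<1+n j))

  initial : State N
  initial = ⟨ (λ x → block (suc (quota (toℕ x) + toℕ x)) s) , Fin.zero , [] ⟩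

  initial-valid : Initial s initial
  initial-valid = (λ x K → count-block (suc (quota (toℕ x) + toℕ x)) s K) , refl

  initial-shape : ∀ x → ColumnShape 0 0 x (block (suc (quota x + x)) s)
  initial-shape zero    = recipient₀ refl z≤n (λ _ → refl)
  initial-shape (suc x) = pending₀ (s≤s z≤n) z≤n (λ _ → refl)

  play : ∀ j → j < N → Σ (State N) λ S → Star Step initial S × Inv j N S
  play zero    0<N = round 0 N 0 initial 0<N (+-identityʳ N)
                       (refl , (λ ()) , λ x → initial-shape (toℕ x))
  play (suc j) j<N with play j (<-trans (n<1+n j) j<N)
  ... | S , moves , inv with round (suc j) N 0 S j<N (+-identityʳ N) (next-round j S inv)
  ... | S′ , moves′ , inv′ = S′ , moves ◅◅ moves′ , inv′

  last-column : ∀ {col} → ColumnShape m N m col → quota m + s ≤ count col (quota m + s)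
  last-column (donor₀ m<m _ _ _ _)  = ⊥-elim (<-irrefl refl m<m)
  last-column (donor₁ m<m _ _ _ _)  = ⊥-elim (<-irrefl refl m<m)
  last-column (recipient₀ _ N≤m _)  = ⊥-elim (<-irrefl refl N≤m)
  last-column (recipient₁ _ _ e)    =
    ≤-reflexive (sym (trans (count-cong e (quota m + s)) (count-stack (quota m + s))))
  last-column (pending₀ m<m _ _)    = ⊥-elim (<-irrefl refl m<m)
  last-column (pending₁ m<m _ _)    = ⊥-elim (<-irrefl refl m<m)

  achievable : Achievable N s (s + quota m)
  achievable with play m (n<1+n m)
  ... | S , moves , (_ , _ , shapes) =
    initial , S , initial-valid , moves , lastFin , quota m + s ,
    subst (_≤ count (board S lastFin) (quota m + s)) (+-comm (quota m) s)
      (last-column (subst (λ x → ColumnShape m N x (board S lastFin)) (toℕ-fromℕ< (n<1+n m)) (shapes lastFin)))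
    where
    lastFin : Fin N
    lastFin = fromℕ< (n<1+n m)

theorem3p7 : ∀ (n s : ℕ) → 1 ≤ n → 1 ≤ s →
    Σ ℕ λ k → Achievable n s k × s ≤ k × 8 * n * s ≤ (2 * k + 3 * s) ^ 2
theorem3p7 (suc m) (suc s') (s≤s z≤n) (s≤s z≤n) =
  suc s' + quota m , Strategy.achievable s' m , m≤m+n (suc s') (quota m) , quota-large m
  where open Schedule s'
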